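{- If $G$ is a layered graph over $\Sigma_{in}$, then there exist at most $(|\Sigma_{in}|+1)^{2s}$ rooted subtrees of $G$ of size $s$.
   Context: A layered graph over $\Sigma_{in}$: directed graph with vertex layers $0,1,\dots$, a single root in layer $0$, each vertex in layer $i$ (below the last layer) having exactly $|\Sigma_{in}|$ out-edges into layer $i+1$, one per symbol of $\Sigma_{in}$ (endpoints not necessarily distinct). A rooted subtree is a set of edges forming a tree (as a subgraph) containing the root, with all edges directed away from the root; its size is its number of edges. -}

module Defs where

open import Data.Nat using (ℕ; zero; suc; _<_; _≤_; _^_; _*_)
open import Data.Fin using (Fin)
open import Data.Product using (Σ; _×_; _,_)
open import Data.List using (List; length)
open import Data.List.Membership.Propositional using (_∈_)
open import Data.List.Relation.Unary.Unique.Propositional using (Unique)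
open import Data.List.Relation.Binary.Subset.Propositional using (_⊆_)
open import Relation.Binary.PropositionalEquality using (_≡_)
open import Relation.Nullary using (¬_)

-- A layered graph over the alphabet Σ_in = Fin k.  Every vertex v of layer i < depth has,
-- for each symbol a, one out-edge (i , v , a) to vertex  next i _ v a  of layer i+1
-- (targets of different symbols may coincide: the edges are still distinct).
record LayeredGraph (k : ℕ) : Set where
  field
    depth   : ℕ
    size    : ℕ → ℕ
    rootLay : size 0 ≡ 1
    next    : (i : ℕ) → i < depth → Fin (size i) → Fin k → Fin (size (suc i))

module _ {k : ℕ} (G : LayeredGraph k) where
  open LayeredGraph G

  Vertex : Set
  Vertex = Σ ℕ λ i → Fin (size i)

  root : Vertex
  root = 0 , Data.Fin.cast (Relation.Binary.PropositionalEquality.sym rootLay) Data.Fin.zero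

  record Edge : Set where
    constructor edge
    field
      layer  : ℕ
      below  : layer < depth
      src    : Fin (size layer)
      symbol : Fin k

  source : Edge → Vertex
  source (edge i _ v _) = i , v

  target : Edge → Vertex
  target (edge i p v a) = suc i , next i p v a

  data Reachable (E : List Edge) : Vertex → Set where
    here : Reachable E root
    step : ∀ {e w} → e ∈ E → target e ≡ w → Reachable E (source e) → Reachable E w

  -- A rooted subtree, given as a duplicate-free list of edges (its edge set):
  -- an arborescence rooted at the root, i.e. every edge starts at a vertex
  -- reachable from the root inside E, and every vertex has at most one
  -- incoming edge in E (so E forms a tree containing the root, directed away from it).
  record RootedSubtree (E : List Edge) : Set where
    field
      distinct  : Unique E
      connected : ∀ {e} → e ∈ E → Reachable E (source e)
      indegree  : ∀ {e e′} → e ∈ E → e′ ∈ E → target e ≡ target e′ → e ≡ e′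

  treeSize : List Edge → ℕ
  treeSize = length

  SameEdgeSet : List Edge → List Edge → Set
  SameEdgeSet E F = E ⊆ F × F ⊆ E

-- Count more generally the duplicate-free edge sets X hanging off a list of roots
-- v ∷ vs, i.e. every edge of X starts at a vertex reachable from a root inside X.  With n roots and s edges there are at most
-- (k+1)^(n+2s−1) of them (exponent truncated at 0; for s = 0 only X = [] exists).
-- For s ≥ 1 classify X by the symbol of an edge of X leaving v, if any.  If there
-- is none, v can be dropped: n−1 roots, s edges.  If the symbol is a, every X of
-- that class contains the one edge of G leaving v with symbol a, and deleting it
-- leaves pairwise different sets of s−1 edges hanging off its target ∷ v ∷ vs:
-- n+1 roots.  So each of the k+1 classes has at most (k+1)^(n+2s−2) members.
module Submission where

open import Defs
open import Data.Nat using (ℕ; zero; suc; pred; _≤_; _^_; _*_; _+_; z≤n; _≟_)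
open import Data.Nat.Properties
  using (<-irrelevant; +-suc; *-suc; ≤-refl; ≤-trans; +-mono-≤; m^n>0; 0≢1+n; suc-injective
        ; module ≤-Reasoning)
open import Data.Fin using (Fin)
import Data.Fin as Fin
open import Data.Maybe using (Maybe; just; nothing)
import Data.Maybe.Properties as Maybe
open import Data.Product using (_×_; _,_; proj₁; proj₂; ∃-syntax)
import Data.Product.Properties as Product
open import Data.Empty using (⊥; ⊥-elim)
open import Data.List using (List; []; _∷_; [_]; length; filter; map; allFin)
open import Data.List.Properties
  using (filter-accept; filter-reject; filter-all; length-map; length-tabulate)
open import Data.List.Relation.Unary.All using (All; []; _∷_)
import Data.List.Relation.Unary.All as All
import Data.List.Relation.Unary.All.Properties as All
open import Data.List.Relation.Unary.AllPairs using (AllPairs; []; _∷_)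
import Data.List.Relation.Unary.AllPairs.Properties as AllPairs
open import Data.List.Relation.Unary.Any using (Any; here; there; any?)
open import Data.List.Membership.Propositional using (_∈_; find; lose)
open import Data.List.Membership.Propositional.Properties
  using (∈-filter⁺; ∈-filter⁻; ∈-map⁺; ∈-allFin)
open import Data.List.Relation.Binary.Subset.Propositional using (_⊆_)
import Data.List.Relation.Binary.Sublist.Propositional.Properties as Sublist
open import Data.List.Relation.Unary.Unique.Propositional using (Unique)
import Data.List.Relation.Unary.Unique.Propositional.Properties as Unique
open import Function using (_∘_)
open import Relation.Binary.Definitions using (DecidableEquality)
open import Relation.Binary.PropositionalEquality
  using (_≡_; _≢_; refl; sym; trans; cong; subst; module ≡-Reasoning)
open import Relation.Nullary using (¬_; yes; no; ¬?)
open import Relation.Unary using (Pred; Decidable)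
open import Relation.Unary.Properties using (∁?)

module _ {a p} {A : Set a} {P : Pred A p} (P? : Decidable P) where

  length-filter+∁ : ∀ xs → length (filter P? xs) + length (filter (∁? P?) xs) ≡ length xs
  length-filter+∁ [] = refl
  length-filter+∁ (x ∷ xs) with P? x
  ... | yes _ = cong suc (length-filter+∁ xs)
  ... | no _ = trans (+-suc _ _) (cong suc (length-filter+∁ xs))

+-2*suc : ∀ n s → n + 2 * suc s ≡ suc (suc (n + 2 * s))
+-2*suc n s = begin
  n + 2 * suc s           ≡⟨ cong (n +_) (*-suc 2 s) ⟩
  n + suc (suc (2 * s))   ≡⟨ +-suc n (suc (2 * s)) ⟩
  suc (n + suc (2 * s))   ≡⟨ cong suc (+-suc n (2 * s)) ⟩
  suc (suc (n + 2 * s))   ∎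
  where open ≡-Reasoning

module _ {a b} {A : Set a} {B : Set b} (_≟ᴮ_ : DecidableEquality B) (key : A → B) where

  length≤#keys*class : ∀ (bs : List B) xs {c}
    → All (λ x → key x ∈ bs) xs
    → (∀ b → length (filter (λ x → key x ≟ᴮ b) xs) ≤ c)
    → length xs ≤ length bs * c
  length≤#keys*class [] [] _ _ = z≤n
  length≤#keys*class [] (x ∷ xs) (() ∷ _) _
  length≤#keys*class (b ∷ bs) xs {c} keys classes = begin
    length xs
      ≡⟨ sym (length-filter+∁ (class b) xs) ⟩
    length (filter (class b) xs) + length others
      ≤⟨ +-mono-≤ (classes b) (length≤#keys*class bs others keys′ classes′) ⟩
    c + length bs * c ∎
    where
    open ≤-Reasoning
    class : ∀ b → Decidable (λ x → key x ≡ b)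
    class b x = key x ≟ᴮ b

    others = filter (∁? (class b)) xs

    keys′ : All (λ x → key x ∈ bs) others
    keys′ = All.zipWith (λ { (here eq , ≢b) → ⊥-elim (≢b eq) ; (there ∈bs , _) → ∈bs })
                        (All.filter⁺ (∁? (class b)) keys , All.all-filter (∁? (class b)) xs)

    classes′ : ∀ b′ → length (filter (class b′) others) ≤ c
    classes′ b′ = ≤-trans (Sublist.length-mono-≤ others-class⊆class) (classes b′)
      where
      others-class⊆class = Sublist.filter⁺ (class b′) (class b′) (λ { refl Px → Px })
                                           (Sublist.filter-⊆ (∁? (class b)) xs)

module _ {a p r s} {A : Set a} {P : Pred A p} {R : A → A → Set r} {S : A → A → Set s} where

  allPairs-under-all : (∀ {x y} → P x → P y → R x y → S x y)
    → ∀ {xs} → All P xs → AllPairs R xs → AllPairs S xs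
  allPairs-under-all f [] [] = []
  allPairs-under-all f (px ∷ pxs) (rxs ∷ rxss) =
    All.zipWith (λ (py , rxy) → f px py rxy) (pxs , rxs) ∷ allPairs-under-all f pxs rxss

module _ {a} {A : Set a} where

  pairwise-different-empty-lists : ∀ (Xs : List (List A)) → All (λ X → length X ≡ 0) Xs
    → AllPairs (λ X Y → ¬ (X ⊆ Y × Y ⊆ X)) Xs → length Xs ≤ 1
  pairwise-different-empty-lists [] _ _ = z≤n
  pairwise-different-empty-lists (_ ∷ []) _ _ = ≤-refl
  pairwise-different-empty-lists ([] ∷ [] ∷ _) _ ((≉ ∷ _) ∷ _) = ⊥-elim (≉ ((λ ()) , (λ ())))
  pairwise-different-empty-lists ((_ ∷ _) ∷ _ ∷ _) (() ∷ _) _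
  pairwise-different-empty-lists ([] ∷ (_ ∷ _) ∷ _) (_ ∷ () ∷ _) _

module _ {k : ℕ} (G : LayeredGraph k) where
  open LayeredGraph G
  open Edge

  _≟ⱽ_ : DecidableEquality (Vertex G)
  _≟ⱽ_ = Product.≡-dec _≟_ Fin._≟_

  edge-determined : ∀ {e e′ : Edge G}
    → source G e ≡ source G e′ → symbol e ≡ symbol e′ → e ≡ e′
  edge-determined {edge i p v a} {edge .i q .v .a} refl refl =
    cong (λ p → edge i p v a) (<-irrelevant p q)

  _≟ᴱ_ : DecidableEquality (Edge G)
  edge i p v a ≟ᴱ edge j q w b with i ≟ j
  ... | no i≢j = no (i≢j ∘ cong layer)
  ... | yes refl with v Fin.≟ w | a Fin.≟ b
  ... | yes refl | yes refl = yes (edge-determined refl refl)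
  ... | no v≢w | _ = no λ { refl → v≢w refl }
  ... | yes _ | no a≢b = no λ { refl → a≢b refl }

  data ReachableFrom (roots : List (Vertex G)) (X : List (Edge G)) : Vertex G → Set where
    start : ∀ {v} → v ∈ roots → ReachableFrom roots X v
    step  : ∀ {e w} → e ∈ X → target G e ≡ w
      → ReachableFrom roots X (source G e) → ReachableFrom roots X w

  record Rooted (roots : List (Vertex G)) (X : List (Edge G)) : Set where
    field
      distinct  : Unique X
      connected : ∀ {e} → e ∈ X → ReachableFrom roots X (source G e)
  open Rooted

  subtree-rooted : ∀ {X} → RootedSubtree G X → Rooted [ root G ] X
  subtree-rooted T = record
    { distinct  = RootedSubtree.distinct T
    ; connected = lift ∘ RootedSubtree.connected T
    }
    where
    lift : ∀ {X w} → Reachable G X w → ReachableFrom [ root G ] X w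
    lift here = start (here refl)
    lift (step e∈X eq r) = step e∈X eq (lift r)

  rootless-empty : ∀ {X} → Rooted [] X → X ≡ []
  rootless-empty {[]} _ = refl
  rootless-empty {_ ∷ _} R = ⊥-elim (unreachable (connected R (here refl)))
    where
    unreachable : ∀ {X w} → ReachableFrom [] X w → ⊥
    unreachable (step _ _ r) = unreachable r

  Leaves : Vertex G → List (Edge G) → Set
  Leaves v X = Any (λ e → source G e ≡ v) X

  pop-root : ∀ {v vs X} → ¬ Leaves v X → Rooted (v ∷ vs) X → Rooted vs X
  pop-root {v} {vs} {X} ¬leaves R = record
    { distinct  = distinct R
    ; connected = λ e∈X → pop (connected R e∈X) (¬leaves ∘ lose e∈X)
    }
    where
    pop : ∀ {w} → ReachableFrom (v ∷ vs) X w → w ≢ v → ReachableFrom vs X w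
    pop (start (here w≡v)) w≢v = ⊥-elim (w≢v w≡v)
    pop (start (there w∈vs)) _ = start w∈vs
    pop (step e∈X eq r) _ = step e∈X eq (pop r (¬leaves ∘ lose e∈X))

  without : Edge G → List (Edge G) → List (Edge G)
  without e = filter (λ x → ¬? (x ≟ᴱ e))

  ∈-without⁺ : ∀ {e x X} → x ∈ X → x ≢ e → x ∈ without e X
  ∈-without⁺ {e} = ∈-filter⁺ (λ x → ¬? (x ≟ᴱ e))

  ∈-without⁻ : ∀ {e x X} → x ∈ without e X → x ∈ X
  ∈-without⁻ {e} = proj₁ ∘ ∈-filter⁻ (λ x → ¬? (x ≟ᴱ e))

  length-without : ∀ {e X} → Unique X → e ∈ X → suc (length (without e X)) ≡ length X
  length-without {e} {X = _ ∷ xs} (e∉xs ∷ _) (here refl)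
    rewrite filter-reject (λ x → ¬? (x ≟ᴱ e)) {e} {xs} (λ e≢e → e≢e refl)
          | filter-all (λ x → ¬? (x ≟ᴱ e)) (All.map (_∘ sym) e∉xs) = refl
  length-without {e} {X = x ∷ xs} (x∉xs ∷ u) (there e∈xs)
    rewrite filter-accept (λ x → ¬? (x ≟ᴱ e)) {x} {xs} (All.lookup x∉xs e∈xs)
    = cong suc (length-without u e∈xs)

  remove-edge : ∀ {e vs X} → Rooted vs X → Rooted (target G e ∷ vs) (without e X)
  remove-edge {e} {vs} {X} R = record
    { distinct  = Unique.filter⁺ (λ x → ¬? (x ≟ᴱ e)) (distinct R)
    ; connected = reroute ∘ connected R ∘ ∈-without⁻
    }
    where
    reroute : ∀ {w} → ReachableFrom vs X w → ReachableFrom (target G e ∷ vs) (without e X) w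
    reroute (start w∈vs) = start (there w∈vs)
    reroute (step {e′} e′∈X eq r) with e′ ≟ᴱ e
    ... | yes refl = start (here (sym eq))
    ... | no e′≢e = step (∈-without⁺ e′∈X e′≢e) eq (reroute r)

  without-different : ∀ {e X Y} → e ∈ X → e ∈ Y
    → ¬ SameEdgeSet G X Y → ¬ SameEdgeSet G (without e X) (without e Y)
  without-different {e} e∈X e∈Y X≉Y (X⊆Y , Y⊆X) = X≉Y (restore X⊆Y e∈Y , restore Y⊆X e∈X)
    where
    restore : ∀ {X Y} → without e X ⊆ without e Y → e ∈ Y → X ⊆ Y
    restore ⊆′ e∈Y {x} x∈X with x ≟ᴱ e
    ... | yes refl = e∈Y
    ... | no x≢e = ∈-without⁻ (⊆′ (∈-without⁺ x∈X x≢e))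

  outSymbol : Vertex G → List (Edge G) → Maybe (Fin k)
  outSymbol v X with any? (λ e → source G e ≟ⱽ v) X
  ... | yes leaves = just (symbol (proj₁ (find leaves)))
  ... | no _ = nothing

  outSymbol≡nothing : ∀ {v X} → outSymbol v X ≡ nothing → ¬ Leaves v X
  outSymbol≡nothing {v} {X} eq with any? (λ e → source G e ≟ⱽ v) X
  ... | no ¬leaves = ¬leaves

  outSymbol≡just : ∀ {v X a} → outSymbol v X ≡ just a
    → ∃[ e ] e ∈ X × source G e ≡ v × symbol e ≡ a
  outSymbol≡just {v} {X} eq with any? (λ e → source G e ≟ⱽ v) X
  outSymbol≡just refl | yes leaves = let (e , e∈X , e-leaves) = find leaves in e , e∈X , e-leaves , refl

  shared-out-edge : ∀ {v X a} → outSymbol v X ≡ just a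
    → ∃[ e ] ∀ {Y} → outSymbol v Y ≡ just a → e ∈ Y
  shared-out-edge X-out with outSymbol≡just X-out
  ... | e , _ , e-leaves , e-symbol = e , λ Y-out →
    let (e′ , e′∈Y , e′-leaves , e′-symbol) = outSymbol≡just Y-out
    in subst (_∈ _) (edge-determined (trans e′-leaves (sym e-leaves)) (trans e′-symbol (sym e-symbol)))
             e′∈Y

  RootedOfSize : List (Vertex G) → ℕ → List (Edge G) → Set
  RootedOfSize vs s X = Rooted vs X × length X ≡ s

  Different : List (Edge G) → List (Edge G) → Set
  Different X Y = ¬ SameEdgeSet G X Y

  remove-shared-edge : ∀ {e vs s Ts}
    → All (e ∈_) Ts → All (RootedOfSize vs (suc s)) Ts → AllPairs Different Ts
    → All (RootedOfSize (target G e ∷ vs) s) (map (without e) Ts) × AllPairs Different (map (without e) Ts)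
  remove-shared-edge {e} shared sized different =
      All.map⁺ (All.zipWith shrink (shared , sized))
    , AllPairs.map⁺ (allPairs-under-all without-different shared different)
    where
    shrink : ∀ {X} → e ∈ X × RootedOfSize _ (suc _) X → RootedOfSize _ _ (without e X)
    shrink (e∈X , R , |X|≡1+s) =
      remove-edge R , suc-injective (trans (length-without (distinct R) e∈X) |X|≡1+s)

  symbols : List (Maybe (Fin k))
  symbols = nothing ∷ map just (allFin k)

  ∈-symbols : ∀ a → a ∈ symbols
  ∈-symbols nothing = here refl
  ∈-symbols (just a) = there (∈-map⁺ just (∈-allFin a))

  length-symbols : length symbols ≡ suc k
  length-symbols = cong suc (trans (length-map just (allFin k)) (length-tabulate (λ a → a)))

  CountBound : ℕ → Set
  CountBound s = ∀ vs Ts → All (RootedOfSize vs s) Ts → AllPairs Different Ts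
    → length Ts ≤ suc k ^ pred (length vs + 2 * s)

  count-edgeless : CountBound zero
  count-edgeless vs Ts sized different =
    ≤-trans (pairwise-different-empty-lists Ts (All.map proj₂ sized) different)
            (m^n>0 (suc k) (pred (length vs + 2 * 0)))

  count-symbol-class : ∀ {s v vs a} → CountBound s → ∀ Cs
    → All (λ X → RootedOfSize (v ∷ vs) (suc s) X × outSymbol v X ≡ just a) Cs → AllPairs Different Cs
    → length Cs ≤ suc k ^ suc (length vs + 2 * s)
  count-symbol-class ih [] _ _ = z≤n
  count-symbol-class {s} {v} {vs} ih Cs@(_ ∷ _) members@((_ , X-out) ∷ _) different =
    let (e , e∈) = shared-out-edge X-out
        (sized′ , different′) =
          remove-shared-edge (All.map (e∈ ∘ proj₂) members) (All.map proj₁ members) different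
    in subst (_≤ suc k ^ suc (length vs + 2 * s)) (length-map (without e) Cs)
         (ih (target G e ∷ v ∷ vs) (map (without e) Cs) sized′ different′)

  count-step : ∀ {s} → CountBound s → CountBound (suc s)
  count-step ih [] [] _ _ = z≤n
  count-step ih [] (X ∷ _) ((R , |X|≡1+s) ∷ _) _ =
    ⊥-elim (0≢1+n (trans (cong length (sym (rootless-empty R))) |X|≡1+s))
  count-step {s} ih (v ∷ vs) Ts sized different = begin
    length Ts
      ≤⟨ length≤#keys*class Maybe≟ (outSymbol v) symbols Ts
           (All.tabulate λ {X} _ → ∈-symbols (outSymbol v X)) class-bound ⟩
    length symbols * suc k ^ suc (length vs + 2 * s)
      ≡⟨ cong (_* suc k ^ suc (length vs + 2 * s)) length-symbols ⟩
    suc k ^ suc (suc (length vs + 2 * s))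
      ≡⟨ cong (λ m → suc k ^ pred m) (sym (+-2*suc (suc (length vs)) s)) ⟩
    suc k ^ pred (suc (length vs) + 2 * suc s) ∎
    where
    open ≤-Reasoning
    Maybe≟ = Maybe.≡-dec Fin._≟_

    class : ∀ a → Decidable (λ X → outSymbol v X ≡ a)
    class a X = Maybe≟ (outSymbol v X) a

    members : ∀ a
      → All (λ X → RootedOfSize (v ∷ vs) (suc s) X × outSymbol v X ≡ a) (filter (class a) Ts)
    members a = All.zip (All.filter⁺ (class a) sized , All.all-filter (class a) Ts)

    class-bound : ∀ a → length (filter (class a) Ts) ≤ suc k ^ suc (length vs + 2 * s)
    class-bound nothing =
      subst (λ m → length (filter (class nothing) Ts) ≤ suc k ^ pred m) (+-2*suc (length vs) s)
        (count-step ih vs (filter (class nothing) Ts)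
          (All.map (λ ((R , size) , no-out) → pop-root (outSymbol≡nothing no-out) R , size)
                   (members nothing))
          (AllPairs.filter⁺ (class nothing) different))
    class-bound (just a) =
      count-symbol-class ih (filter (class (just a)) Ts) (members (just a))
        (AllPairs.filter⁺ (class (just a)) different)

  count-rooted : ∀ s → CountBound s
  count-rooted zero = count-edgeless
  count-rooted (suc s) = count-step (count-rooted s)

lemma5p8 : {k : ℕ} (G : LayeredGraph k) (s : ℕ) (Ts : List (List (Edge G)))
    → All (RootedSubtree G) Ts
    → All (λ E → treeSize G E ≡ s) Ts
    → AllPairs (λ E F → ¬ SameEdgeSet G E F) Ts
    → length Ts ≤ suc k ^ (2 * s)
lemma5p8 G s Ts subtrees sizes different =
  count-rooted G s [ root G ] Ts (All.zip (All.map (subtree-rooted G) subtrees , sizes)) different
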